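{- For every positive integer $n$, $m_6(C_3,C_3,nK_2)=n$.
   Context: $K_{j\times t}$ denotes the complete multipartite graph with $j$ partite sets, each of size $t$. For graphs $H_1,\ldots,H_k$, the multipartite Ramsey number $m_j(H_1,\ldots,H_k)$ is the smallest positive integer $t$ such that for every $k$-edge-coloring $(G^1,\ldots,G^k)$ of $K_{j\times t}$ (partition of its edges into spanning subgraphs), some $G^\ell$ contains a copy of $H_\ell$; it is $\infty$ if no such $t$ exists. $C_3$ is the triangle and $nK_2$ is a matching of $n$ edges. -}

module Defs where

open import Level using (0ℓ)
open import Data.Nat using (ℕ; _<_)
open import Data.Fin using (Fin; zero; suc)
open import Data.Product using (Σ; ∃; _×_; _,_)
open import Relation.Nullary using (¬_)
open import Relation.Binary.PropositionalEquality using (_≡_; _≢_)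
open import Function.Definitions using (Injective)

record Graph : Set₁ where
  field
    V : Set
    E : V → V → Set
open Graph public

-- Vertices of K_{j×t}: pairs (part, index within part).
KVert : ℕ → ℕ → Set
KVert j t = Fin j × Fin t

KAdj : ∀ {j t} → KVert j t → KVert j t → Set
KAdj (a , _) (b , _) = a ≢ b

-- A k-edge-colouring of K_{j×t}: each edge {u,v} gets one colour in Fin k
-- (a colour function on ordered pairs, symmetric on edges; values on non-edges irrelevant).
-- This is the same as a partition of the edges into k spanning subgraphs G^1..G^k,
-- where G^ℓ has the edges of colour ℓ.
record Colouring (j t k : ℕ) : Set where
  field
    col : KVert j t → KVert j t → Fin k
    sym : ∀ u v → KAdj u v → col u v ≡ col v u
open Colouring public

ContainsCopy : ∀ {j t k} → Colouring j t k → Fin k → Graph → Set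
ContainsCopy {j} {t} c ℓ H =
  Σ (V H → KVert j t) λ φ →
    Injective _≡_ _≡_ φ ×
    (∀ a b → E H a b → KAdj (φ a) (φ b) × col c (φ a) (φ b) ≡ ℓ)

Arrows : (j t k : ℕ) → (Fin k → Graph) → Set
Arrows j t k H = ∀ (c : Colouring j t k) → ∃ λ ℓ → ContainsCopy c ℓ (H ℓ)

MultipartiteRamseyIs : (j k : ℕ) → (Fin k → Graph) → ℕ → Set
MultipartiteRamseyIs j k H t =
  0 < t × Arrows j t k H × (∀ s → 0 < s → s < t → ¬ Arrows j s k H)

C3 : Graph
C3 = record { V = Fin 3 ; E = λ a b → a ≢ b }

matching : ℕ → Graph
matching n = record { V = Fin n × Fin 2
                    ; E = λ { (i , a) (i' , a') → i ≡ i' × a ≢ a' } }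

triple : Graph → Graph → Graph → Fin 3 → Graph
triple H₁ H₂ H₃ zero = H₁
triple H₁ H₂ H₃ (suc zero) = H₂
triple H₁ H₂ H₃ (suc (suc zero)) = H₃

-- Upper bound: for each index i the vertices (p , i), one per part, span a K₆.  If none of
-- these n transversals has an edge of the third colour, some transversal is 2-coloured and
-- contains a monochromatic triangle by R(3,3) = 6; otherwise one third-colour edge from each
-- transversal gives n disjoint edges.  Lower bound: colour K_{6×s} according to the parts,
-- joining part 0 to everything in the third colour and colouring parts 1..5 like the
-- triangle-free pentagon/pentagram 2-colouring of K₅.  There is no monochromatic triangle,
-- and part 0 (of size s) covers every third-colour edge, so no third-colour matching has
-- more than s edges.
module Submission where

open import Defs hiding (sym)
open import Data.Bool using (Bool; true; false; _∨_; if_then_else_)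
open import Data.Bool.Properties using (∨-comm)
open import Data.Nat using (ℕ; _<_; _≤_)
open import Data.Nat.DivMod using (_mod_)
open import Data.Nat.Properties using (<⇒≱)
open import Data.Fin using (Fin; zero; suc; toℕ; #_)
open import Data.Fin.Properties using (_≟_; 0≢1+n; suc-injective; any?; all?; ¬∀⟶∃¬; injective⇒≤)
open import Data.Product using (∃; _×_; _,_; proj₁; proj₂)
open import Data.Sum using (_⊎_; inj₁; inj₂; swap)
open import Function using (_∘_)
open import Function.Definitions using (Injective)
open import Relation.Nullary using (¬_; Dec; yes; no; does; contradiction)
open import Relation.Nullary.Decidable using (False; toWitnessFalse; map′; from-no; ¬?; _×-dec_)
open import Relation.Binary.PropositionalEquality using (_≡_; _≢_; refl; sym; trans; cong; cong₂; ≢-sym)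

record Edge {V A : Set} (f : V → V → A) (a : A) : Set where
  constructor edge
  field
    x y : V
    x≢y : x ≢ y
    xy  : f x y ≡ a

record Triangle {V A : Set} (f : V → V → A) (a : A) : Set where
  constructor triangle
  field
    x y z : V
    x≢y : x ≢ y
    x≢z : x ≢ z
    y≢z : y ≢ z
    xy  : f x y ≡ a
    xz  : f x z ≡ a
    yz  : f y z ≡ a

module _ {n k : ℕ} (f : Fin n → Fin n → Fin k) (a : Fin k) where

  edge? : Dec (Edge f a)
  edge? = map′ (λ (x , y , x≢y , xy) → edge x y x≢y xy)
               (λ (edge x y x≢y xy) → x , y , x≢y , xy)
               (any? λ x → any? λ y → ¬? (x ≟ y) ×-dec (f x y ≟ a))

  triangle? : Dec (Triangle f a)
  triangle? =
    map′ (λ (x , y , z , x≢y , x≢z , y≢z , xy , xz , yz) → triangle x y z x≢y x≢z y≢z xy xz yz)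
         (λ (triangle x y z x≢y x≢z y≢z xy xz yz) → x , y , z , x≢y , x≢z , y≢z , xy , xz , yz)
         (any? λ x → any? λ y → any? λ z →
            ¬? (x ≟ y) ×-dec ¬? (x ≟ z) ×-dec ¬? (y ≟ z) ×-dec
            (f x y ≟ a) ×-dec (f x z ≟ a) ×-dec (f y z ≟ a))

record ThreeOf {n : ℕ} (P : Fin n → Set) : Set where
  constructor three
  field
    i j k : Fin n
    i≢j : i ≢ j
    i≢k : i ≢ k
    j≢k : j ≢ k
    Pi  : P i
    Pj  : P j
    Pk  : P k

threeAt : ∀ {n} {P : Fin n → Set} i j k
          {i≢j : False (i ≟ j)} {i≢k : False (i ≟ k)} {j≢k : False (j ≟ k)} →
          P i → P j → P k → ThreeOf P
threeAt i j k {i≢j} {i≢k} {j≢k} =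
  three i j k (toWitnessFalse i≢j) (toWitnessFalse i≢k) (toWitnessFalse j≢k)

three-of-five : {P Q : Fin 5 → Set} → (∀ i → P i ⊎ Q i) → ThreeOf P ⊎ ThreeOf Q
three-of-five side with side (# 0) | side (# 1) | side (# 2) | side (# 3) | side (# 4)
... | inj₁ p₀ | inj₁ p₁ | inj₁ p₂ | _       | _       = inj₁ (threeAt (# 0) (# 1) (# 2) p₀ p₁ p₂)
... | inj₂ q₀ | inj₂ q₁ | inj₂ q₂ | _       | _       = inj₂ (threeAt (# 0) (# 1) (# 2) q₀ q₁ q₂)
... | inj₁ p₀ | inj₁ p₁ | inj₂ _  | inj₁ p₃ | _       = inj₁ (threeAt (# 0) (# 1) (# 3) p₀ p₁ p₃)
... | inj₂ q₀ | inj₂ q₁ | inj₁ _  | inj₂ q₃ | _       = inj₂ (threeAt (# 0) (# 1) (# 3) q₀ q₁ q₃)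
... | inj₁ p₀ | inj₂ _  | inj₁ p₂ | inj₁ p₃ | _       = inj₁ (threeAt (# 0) (# 2) (# 3) p₀ p₂ p₃)
... | inj₂ q₀ | inj₁ _  | inj₂ q₂ | inj₂ q₃ | _       = inj₂ (threeAt (# 0) (# 2) (# 3) q₀ q₂ q₃)
... | inj₂ _  | inj₁ p₁ | inj₁ p₂ | inj₁ p₃ | _       = inj₁ (threeAt (# 1) (# 2) (# 3) p₁ p₂ p₃)
... | inj₁ _  | inj₂ q₁ | inj₂ q₂ | inj₂ q₃ | _       = inj₂ (threeAt (# 1) (# 2) (# 3) q₁ q₂ q₃)
... | inj₁ p₀ | inj₁ p₁ | inj₂ _  | inj₂ _  | inj₁ p₄ = inj₁ (threeAt (# 0) (# 1) (# 4) p₀ p₁ p₄)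
... | inj₁ _  | inj₁ _  | inj₂ q₂ | inj₂ q₃ | inj₂ q₄ = inj₂ (threeAt (# 2) (# 3) (# 4) q₂ q₃ q₄)
... | inj₂ q₀ | inj₂ q₁ | inj₁ _  | inj₁ _  | inj₂ q₄ = inj₂ (threeAt (# 0) (# 1) (# 4) q₀ q₁ q₄)
... | inj₂ _  | inj₂ _  | inj₁ p₂ | inj₁ p₃ | inj₁ p₄ = inj₁ (threeAt (# 2) (# 3) (# 4) p₂ p₃ p₄)
... | inj₁ p₀ | inj₂ _  | inj₁ p₂ | inj₂ _  | inj₁ p₄ = inj₁ (threeAt (# 0) (# 2) (# 4) p₀ p₂ p₄)
... | inj₁ _  | inj₂ q₁ | inj₁ _  | inj₂ q₃ | inj₂ q₄ = inj₂ (threeAt (# 1) (# 3) (# 4) q₁ q₃ q₄)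
... | inj₂ q₀ | inj₁ _  | inj₂ q₂ | inj₁ _  | inj₂ q₄ = inj₂ (threeAt (# 0) (# 2) (# 4) q₀ q₂ q₄)
... | inj₂ _  | inj₁ p₁ | inj₂ _  | inj₁ p₃ | inj₁ p₄ = inj₁ (threeAt (# 1) (# 3) (# 4) p₁ p₃ p₄)
... | inj₂ _  | inj₁ p₁ | inj₁ p₂ | inj₂ _  | inj₁ p₄ = inj₁ (threeAt (# 1) (# 2) (# 4) p₁ p₂ p₄)
... | inj₂ q₀ | inj₁ _  | inj₁ _  | inj₂ q₃ | inj₂ q₄ = inj₂ (threeAt (# 0) (# 3) (# 4) q₀ q₃ q₄)
... | inj₁ _  | inj₂ q₁ | inj₂ q₂ | inj₁ _  | inj₂ q₄ = inj₂ (threeAt (# 1) (# 2) (# 4) q₁ q₂ q₄)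
... | inj₁ p₀ | inj₂ _  | inj₂ _  | inj₁ p₃ | inj₁ p₄ = inj₁ (threeAt (# 0) (# 3) (# 4) p₀ p₃ p₄)

TwoColoured : {V A : Set} → (V → V → A) → A → A → Set
TwoColoured f a b = ∀ x y → x ≢ y → f x y ≡ a ⊎ f x y ≡ b

-- Three neighbours of vertex 0 joined to it in colour a: any a-edge among them closes an
-- a-triangle through 0, otherwise they span a b-triangle.
star⇒triangle : {A : Set} {f : Fin 6 → Fin 6 → A} {a b : A} → TwoColoured f a b →
                ThreeOf (λ i → f zero (suc i) ≡ a) → Triangle f a ⊎ Triangle f b
star⇒triangle two (three i j k i≢j i≢k j≢k ai aj ak)
  with two (suc i) (suc j) (i≢j ∘ suc-injective)
     | two (suc i) (suc k) (i≢k ∘ suc-injective)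
     | two (suc j) (suc k) (j≢k ∘ suc-injective)
... | inj₁ aij | _ | _ = inj₁ (triangle zero (suc i) (suc j) 0≢1+n 0≢1+n (i≢j ∘ suc-injective) ai aj aij)
... | _ | inj₁ aik | _ = inj₁ (triangle zero (suc i) (suc k) 0≢1+n 0≢1+n (i≢k ∘ suc-injective) ai ak aik)
... | _ | _ | inj₁ ajk = inj₁ (triangle zero (suc j) (suc k) 0≢1+n 0≢1+n (j≢k ∘ suc-injective) aj ak ajk)
... | inj₂ bij | inj₂ bik | inj₂ bjk =
  inj₂ (triangle (suc i) (suc j) (suc k)
                 (i≢j ∘ suc-injective) (i≢k ∘ suc-injective) (j≢k ∘ suc-injective) bij bik bjk)

ramsey-3-3 : {A : Set} {f : Fin 6 → Fin 6 → A} {a b : A} → TwoColoured f a b →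
             Triangle f a ⊎ Triangle f b
ramsey-3-3 two with three-of-five (λ i → two zero (suc i) 0≢1+n)
... | inj₁ star = star⇒triangle two star
... | inj₂ star = swap (star⇒triangle (λ x y x≢y → swap (two x y x≢y)) star)

module _ {j t k : ℕ} (c : Colouring j t k) where

  transversal : Fin t → Fin j → Fin j → Fin k
  transversal i p q = col c (p , i) (q , i)

  col-flip : ∀ {u v ℓ} → KAdj u v → col c u v ≡ ℓ → col c v u ≡ ℓ
  col-flip {u} {v} uv = trans (sym (Colouring.sym c u v uv))

  transversal-triangle⇒C3 : ∀ {i ℓ} → Triangle (transversal i) ℓ → ContainsCopy c ℓ C3
  transversal-triangle⇒C3 {i} {ℓ} (triangle x y z x≢y x≢z y≢z xy xz yz) = φ , φ-injective , φ-edges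
    where
    φ : Fin 3 → KVert j t
    φ zero             = x , i
    φ (suc zero)       = y , i
    φ (suc (suc zero)) = z , i

    φ-edges : ∀ a b → a ≢ b → KAdj (φ a) (φ b) × col c (φ a) (φ b) ≡ ℓ
    φ-edges zero             (suc zero)       _ = x≢y , xy
    φ-edges zero             (suc (suc zero)) _ = x≢z , xz
    φ-edges (suc zero)       (suc (suc zero)) _ = y≢z , yz
    φ-edges (suc zero)       zero             _ = ≢-sym x≢y , col-flip x≢y xy
    φ-edges (suc (suc zero)) zero             _ = ≢-sym x≢z , col-flip x≢z xz
    φ-edges (suc (suc zero)) (suc zero)       _ = ≢-sym y≢z , col-flip y≢z yz
    φ-edges zero             zero             a≢a = contradiction refl a≢a
    φ-edges (suc zero)       (suc zero)       a≢a = contradiction refl a≢a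
    φ-edges (suc (suc zero)) (suc (suc zero)) a≢a = contradiction refl a≢a

    -- Distinct vertices of C₃ are adjacent, so they land in different parts.
    φ-injective : Injective _≡_ _≡_ φ
    φ-injective {a} {b} φa≡φb with a ≟ b
    ... | yes a≡b = a≡b
    ... | no  a≢b = contradiction (cong proj₁ φa≡φb) (proj₁ (φ-edges a b a≢b))

  transversal-edges⇒matching : ∀ {ℓ} → (∀ i → Edge (transversal i) ℓ) → ContainsCopy c ℓ (matching t)
  transversal-edges⇒matching {ℓ} edges = φ , φ-injective , φ-edges
    where
    open Edge

    φ : Fin t × Fin 2 → KVert j t
    φ (i , zero)     = x (edges i) , i
    φ (i , suc zero) = y (edges i) , i

    φ-injective : Injective _≡_ _≡_ φ
    φ-injective {i , a} {i′ , b} φa≡φb with cong proj₂ φa≡φb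
    φ-injective {i , zero}     {.i , zero}     _     | refl = refl
    φ-injective {i , suc zero} {.i , suc zero} _     | refl = refl
    φ-injective {i , zero}     {.i , suc zero} φa≡φb | refl =
      contradiction (cong proj₁ φa≡φb) (x≢y (edges i))
    φ-injective {i , suc zero} {.i , zero}     φa≡φb | refl =
      contradiction (cong proj₁ φa≡φb) (≢-sym (x≢y (edges i)))

    φ-edges : ∀ u v → E (matching t) u v → KAdj (φ u) (φ v) × col c (φ u) (φ v) ≡ ℓ
    φ-edges (i , zero)     (.i , suc zero) (refl , _) = x≢y (edges i) , xy (edges i)
    φ-edges (i , suc zero) (.i , zero)     (refl , _) =
      ≢-sym (x≢y (edges i)) , col-flip (x≢y (edges i)) (xy (edges i))
    φ-edges (i , zero)     (.i , zero)     (refl , a≢a) = contradiction refl a≢a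
    φ-edges (i , suc zero) (.i , suc zero) (refl , a≢a) = contradiction refl a≢a

  matching≤cover : ∀ {ℓ n} (p : Fin j) →
                   (∀ u v → KAdj u v → col c u v ≡ ℓ → proj₁ u ≡ p ⊎ proj₁ v ≡ p) →
                   ContainsCopy c ℓ (matching n) → n ≤ t
  matching≤cover {ℓ} {n} p cover (φ , φ-injective , φ-edges) = injective⇒≤ g-injective
    where
    endInCover : ∀ i → ∃ λ b → proj₁ (φ (i , b)) ≡ p
    endInCover i with φ-edges (i , zero) (i , suc zero) (refl , λ ())
    ... | adj , coloured with cover _ _ adj coloured
    ...   | inj₁ here  = zero , here
    ...   | inj₂ there = suc zero , there

    g : Fin n → Fin t
    g i = proj₂ (φ (i , proj₁ (endInCover i)))

    g-injective : Injective _≡_ _≡_ g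
    g-injective {i} {i′} gi≡gi′ =
      cong proj₁ (φ-injective (cong₂ _,_ (trans (proj₂ (endInCover i)) (sym (proj₂ (endInCover i′)))) gi≡gi′))

noEdge⇒twoColoured : ∀ {V : Set} {f : V → V → Fin 3} → ¬ Edge f (# 2) → TwoColoured f (# 0) (# 1)
noEdge⇒twoColoured {f = f} noEdge x y x≢y with f x y in fxy
... | zero             = inj₁ refl
... | suc zero         = inj₂ refl
... | suc (suc zero)   = contradiction (edge x y x≢y fxy) noEdge

arrows-C3-C3-matching : ∀ n → Arrows 6 n 3 (triple C3 C3 (matching n))
arrows-C3-C3-matching n c with all? (λ i → edge? (transversal c i) (# 2))
... | yes edges = # 2 , transversal-edges⇒matching c edges
... | no ¬edges with ¬∀⟶∃¬ n _ (λ i → edge? (transversal c i) (# 2)) ¬edges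
...   | i , noEdge with ramsey-3-3 (noEdge⇒twoColoured noEdge)
...     | inj₁ triangle₀ = # 0 , transversal-triangle⇒C3 c triangle₀
...     | inj₂ triangle₁ = # 1 , transversal-triangle⇒C3 c triangle₁

module _ {j k : ℕ} (g : Fin j → Fin j → Fin k) (g-sym : ∀ p q → g p q ≡ g q p) where

  blowUp : ∀ {t} → Colouring j t k
  blowUp = record { col = λ u v → g (proj₁ u) (proj₁ v) ; sym = λ u v _ → g-sym (proj₁ u) (proj₁ v) }

  blowUp-C3⇒triangle : ∀ {t ℓ} → ContainsCopy (blowUp {t}) ℓ C3 → Triangle g ℓ
  blowUp-C3⇒triangle {ℓ = ℓ} (φ , _ , φ-edges) =
    triangle (part (# 0)) (part (# 1)) (part (# 2))
             (apart (# 0) (# 1) λ ()) (apart (# 0) (# 2) λ ()) (apart (# 1) (# 2) λ ())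
             (coloured (# 0) (# 1) λ ()) (coloured (# 0) (# 2) λ ()) (coloured (# 1) (# 2) λ ())
    where
    part : Fin 3 → Fin j
    part = proj₁ ∘ φ

    apart : ∀ a b → a ≢ b → part a ≢ part b
    apart a b = proj₁ ∘ φ-edges a b

    coloured : ∀ a b → a ≢ b → g (part a) (part b) ≡ ℓ
    coloured a b = proj₂ ∘ φ-edges a b

next₅ : Fin 5 → Fin 5
next₅ p = toℕ (suc p) mod 5

cycle-adjacent : Fin 5 → Fin 5 → Bool
cycle-adjacent p q = does (next₅ p ≟ q) ∨ does (next₅ q ≟ p)

-- Vertex 0 is joined to everything in colour 2; vertices 1..5 carry the pentagon (colour 0)
-- and pentagram (colour 1) colouring, the 2-colouring of K₅ without monochromatic triangles.
cone : Fin 6 → Fin 6 → Fin 3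
cone zero    _       = # 2
cone (suc _) zero    = # 2
cone (suc p) (suc q) = if cycle-adjacent p q then # 0 else # 1

cone-sym : ∀ p q → cone p q ≡ cone q p
cone-sym zero    zero    = refl
cone-sym zero    (suc _) = refl
cone-sym (suc _) zero    = refl
cone-sym (suc p) (suc q) = cong (if_then # 0 else # 1) (∨-comm (does (next₅ p ≟ q)) (does (next₅ q ≟ p)))

cone-triangle-free : ∀ ℓ → ¬ Triangle cone ℓ
cone-triangle-free zero             = from-no (triangle? cone zero)
cone-triangle-free (suc zero)       = from-no (triangle? cone (suc zero))
cone-triangle-free (suc (suc zero)) = from-no (triangle? cone (suc (suc zero)))

cone-colour₂⇒apex : ∀ p q → cone p q ≡ # 2 → p ≡ zero ⊎ q ≡ zero
cone-colour₂⇒apex zero    _       _ = inj₁ refl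
cone-colour₂⇒apex (suc _) zero    _ = inj₂ refl
cone-colour₂⇒apex (suc p) (suc q) with cycle-adjacent p q
... | true  = λ ()
... | false = λ ()

¬arrows-C3-C3-matching : ∀ {n s} → s < n → ¬ Arrows 6 s 3 (triple C3 C3 (matching n))
¬arrows-C3-C3-matching s<n arrows with arrows (blowUp cone cone-sym)
... | zero             , copy = cone-triangle-free zero (blowUp-C3⇒triangle cone cone-sym copy)
... | suc zero         , copy = cone-triangle-free (suc zero) (blowUp-C3⇒triangle cone cone-sym copy)
... | suc (suc zero)   , copy =
  <⇒≱ s<n (matching≤cover (blowUp cone cone-sym) zero (λ u v _ → cone-colour₂⇒apex (proj₁ u) (proj₁ v)) copy)

theorem6 : ∀ (n : ℕ) → 0 < n → MultipartiteRamseyIs 6 3 (triple C3 C3 (matching n)) n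
theorem6 n 0<n = 0<n , arrows-C3-C3-matching n , λ s _ s<n → ¬arrows-C3-C3-matching s<n
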